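{- Let $G$ be a connected graph. (i) If $G$ has no simplicial vertex and $H$ is a connected graph with no simplicial vertex, then $\mathrm{gp}_{\rm d}(G\circ H)=0$. (ii) If $n\ge 1$, then $\mathrm{gp}_{\rm d}(G\circ K_n)=n\cdot\mathrm{gp}_{\rm d}(G)$.
   Context: All graphs are finite and simple, and (as a standing assumption of the paper) connected. For $X\subseteq V(G)$, two vertices $u,v$ are $X$-positionable if no shortest $u,v$-path has an internal vertex in $X$. $X$ is a dual general position set if every two vertices of $X$ are $X$-positionable and every two vertices of $V(G)\setminus X$ are $X$-positionable; $\mathrm{gp}_{\rm d}(G)$ is the maximum cardinality of such a set (the empty set is allowed, so the value can be $0$). A vertex is simplicial if its neighbourhood induces a complete subgraph. The lexicographic product $G\circ H$ has vertex set $V(G)\times V(H)$, with $(g,h)$ and $(g',h')$ adjacent iff either $gg'\in E(G)$, or $g=g'$ and $hh'\in E(H)$. $K_n$ is the complete graph on $n$ vertices. -}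

module Defs where

open import Data.Nat using (ℕ; zero; suc; _*_; _≤_)
open import Data.Bool using (Bool; T; not; _∨_; _∧_)
open import Data.Fin using (Fin; remQuot; _≟_)
open import Data.Fin.Subset using (Subset; _∈_; _∉_; ∣_∣)
open import Data.List using (List; []; _∷_)
open import Data.List.Membership.Propositional using () renaming (_∈_ to _∈ₗ_)
open import Data.Product using (Σ; ∃; _×_; _,_; proj₁; proj₂)
open import Relation.Nullary using (¬_; ⌊_⌋)
open import Relation.Binary.PropositionalEquality using (_≡_; _≢_)

record Graph : Set where
  field
    order : ℕ
    adj   : Fin order → Fin order → Bool

open Graph public

V : Graph → Set
V G = Fin (order G)

Adj : (G : Graph) → V G → V G → Set
Adj G u v = T (adj G u v)

record IsSimple (G : Graph) : Set where
  field
    adj-sym    : ∀ u v → Adj G u v → Adj G v u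
    adj-irrefl : ∀ u → ¬ Adj G u u

data Walk (G : Graph) : V G → V G → ℕ → Set where
  []  : ∀ {u} → Walk G u u 0
  _∷_ : ∀ {u w v k} → Adj G u w → Walk G w v k → Walk G u v (suc k)

Connected : Graph → Set
Connected G = ∀ (u v : V G) → ∃ λ k → Walk G u v k

initVerts : ∀ {G u v k} → Walk G u v k → List (V G)
initVerts []                = []
initVerts {u = u} (_ ∷ W)   = u ∷ initVerts W

inner : ∀ {G u v k} → Walk G u v k → List (V G)
inner []      = []
inner (_ ∷ W) = initVerts W

IsShortest : ∀ {G u v k} → Walk G u v k → Set
IsShortest {G} {u} {v} {k} W = ∀ k' → Walk G u v k' → k ≤ k'

Positionable : (G : Graph) → Subset (order G) → V G → V G → Set
Positionable G X u v =
  ∀ k (W : Walk G u v k) → IsShortest W → ∀ x → x ∈ₗ inner W → x ∉ X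

IsDualGP : (G : Graph) → Subset (order G) → Set
IsDualGP G X =
  (∀ u v → u ∈ X → v ∈ X → Positionable G X u v) ×
  (∀ u v → u ∉ X → v ∉ X → Positionable G X u v)

IsGpd : Graph → ℕ → Set
IsGpd G k =
  (Σ (Subset (order G)) λ X → IsDualGP G X × ∣ X ∣ ≡ k) ×
  (∀ X → IsDualGP G X → ∣ X ∣ ≤ k)

Simplicial : (G : Graph) → V G → Set
Simplicial G v = ∀ a b → Adj G v a → Adj G v b → a ≢ b → Adj G a b

NoSimplicial : Graph → Set
NoSimplicial G = ∀ v → ¬ Simplicial G v

K : ℕ → Graph
K n = record { order = n ; adj = λ i j → not ⌊ i ≟ j ⌋ }

_∘ₗ_ : Graph → Graph → Graph
G ∘ₗ H = record
  { order = order G * order H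
  ; adj   = λ i j →
      let p = remQuot (order H) i
          q = remQuot (order H) j
      in adj G (proj₁ p) (proj₁ q)
         ∨ (⌊ proj₁ p ≟ proj₁ q ⌋ ∧ adj H (proj₂ p) (proj₂ q))
  }

-- (i) Around a vertex (g,h) of G ∘ H choose non-adjacent neighbours g₁, g₂ of g and h₁, h₂ of h.
-- The vertices (g₁,h₁), (g₁,h₂), (g₂,h) are pairwise at distance two with (g,h) as a common
-- middle vertex, and two of them lie on the same side of a dual general position set Y, so
-- (g,h) ∉ Y. Hence Y = ∅.
-- (ii) Each layer G × {h} of G ∘ H is isometric to G, so Y meets it in a dual general position
-- set of G, and ∣Y∣ ≤ ∣V(H)∣ · gp_d(G) for every H. Conversely, for H = Kₙ the preimage of a dual
-- general position set X of G is one: vertices of a common fibre are at distance at most one,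
-- and a shortest path between distinct fibres projects to a shortest path of G through the
-- projections of its internal vertices.
module Submission where

open import Defs
open import Data.Bool using (true; false; if_then_else_)
open import Data.Bool.Properties using (T-∨; T-∧)
open import Data.Empty using (⊥-elim)
open import Data.Fin using (Fin; zero; suc; combine; remQuot; _↑ˡ_; _↑ʳ_; _≟_)
open import Data.Fin.Properties using (remQuot-combine; combine-remQuot; combine-injective; any?)
open import Data.Fin.Subset using (Subset; _∈_; _∉_; ∣_∣; ⊥)
open import Data.Fin.Subset.Properties using (_∈?_; ∉⊥; ∣⊥∣≡0; Empty-unique)
open import Data.List.Membership.Propositional using () renaming (_∈_ to _∈ₗ_)
open import Data.List.Relation.Unary.Any using (here; there)
open import Data.Nat using (ℕ; zero; suc; _+_; _*_; _≤_; _≥_; z≤n; s≤s)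
open import Data.Nat.Properties
  using (≤-antisym; ≤-reflexive; ≤-trans; +-assoc; +-mono-≤; +-monoˡ-≤; +-monoʳ-≤;
         +-cancelˡ-≤; +-cancelʳ-≤; m≤n⇒m≤1+n; module ≤-Reasoning; +-*-semiring)
open import Algebra.Properties.Semiring.Sum +-*-semiring
  using (sum; sum-syntax; sum-cong-≗; ∑-comm; *-distribˡ-sum)
open import Data.Product using (_×_; _,_; proj₁; proj₂; Σ; ∃-syntax)
open import Data.Sum as Sum using (_⊎_; inj₁; inj₂)
open import Data.Vec using ([]; _∷_; lookup; tabulate)
open import Data.Vec.Properties using (lookup∘tabulate; []=⇒lookup; lookup⇒[]=)
open import Function using (_∘_; Equivalence)
open import Relation.Nullary using (¬_; yes; no; ⌊_⌋; contradiction)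
open import Relation.Nullary.Decidable using (T?; ¬?; _×-dec_; decidable-stable; toSum; fromWitness; toWitness; fromWitnessFalse)
open import Relation.Binary.PropositionalEquality

+-≤-tight : ∀ {a b c d} → a ≤ c → b ≤ d → c + d ≤ a + b → a ≡ c × b ≡ d
+-≤-tight {a} {b} {c} {d} a≤c b≤d c+d≤a+b =
  ≤-antisym a≤c (+-cancelʳ-≤ d c a (≤-trans c+d≤a+b (+-monoʳ-≤ a b≤d))) ,
  ≤-antisym b≤d (+-cancelˡ-≤ c d b (≤-trans c+d≤a+b (+-monoˡ-≤ b a≤c)))

∑-const : ∀ n c → ∑[ i < n ] c ≡ n * c
∑-const zero    c = refl
∑-const (suc n) c = cong (c +_) (∑-const n c)

∑-mono-≤ : ∀ {n} {f g : Fin n → ℕ} → (∀ i → f i ≤ g i) → sum f ≤ sum g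
∑-mono-≤ {zero}  f≤g = z≤n
∑-mono-≤ {suc n} f≤g = +-mono-≤ (f≤g zero) (∑-mono-≤ (f≤g ∘ suc))

∑-↑ : ∀ m n (f : Fin (m + n) → ℕ) → sum f ≡ ∑[ i < m ] f (i ↑ˡ n) + ∑[ j < n ] f (m ↑ʳ j)
∑-↑ zero    n f = refl
∑-↑ (suc m) n f = trans (cong (f zero +_) (∑-↑ m n (f ∘ suc))) (sym (+-assoc (f zero) _ _))

∑-combine : ∀ m n (f : Fin (m * n) → ℕ) → sum f ≡ ∑[ i < m ] ∑[ j < n ] f (combine i j)
∑-combine zero    n f = refl
∑-combine (suc m) n f =
  trans (∑-↑ n (m * n) f) (cong (∑[ j < n ] f (j ↑ˡ m * n) +_) (∑-combine m n (f ∘ (n ↑ʳ_))))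

χ : ∀ {n} → Subset n → Fin n → ℕ
χ p i = if lookup p i then 1 else 0

∣p∣≡∑χ : ∀ {n} (p : Subset n) → ∣ p ∣ ≡ sum (χ p)
∣p∣≡∑χ []          = refl
∣p∣≡∑χ (true ∷ p)  = cong suc (∣p∣≡∑χ p)
∣p∣≡∑χ (false ∷ p) = ∣p∣≡∑χ p

preimage : ∀ {m n} → (Fin m → Fin n) → Subset n → Subset m
preimage f X = tabulate (lookup X ∘ f)

module _ {m n} (f : Fin m → Fin n) (X : Subset n) where

  lookup-preimage : ∀ i → lookup (preimage f X) i ≡ lookup X (f i)
  lookup-preimage = lookup∘tabulate (lookup X ∘ f)

  ∈-preimage⁺ : ∀ {i} → f i ∈ X → i ∈ preimage f X
  ∈-preimage⁺ {i} fi∈X = lookup⇒[]= i _ (trans (lookup-preimage i) ([]=⇒lookup fi∈X))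

  ∈-preimage⁻ : ∀ {i} → i ∈ preimage f X → f i ∈ X
  ∈-preimage⁻ {i} i∈f⁻¹X = lookup⇒[]= (f i) X (trans (sym (lookup-preimage i)) ([]=⇒lookup i∈f⁻¹X))

  χ-preimage : ∀ i → χ (preimage f X) i ≡ χ X (f i)
  χ-preimage i = cong (if_then 1 else 0) (lookup-preimage i)

Walk⁰⇒≡ : ∀ {G u v} → Walk G u v 0 → u ≡ v
Walk⁰⇒≡ [] = refl

Walk¹⇒Adj : ∀ {G u v} → Walk G u v 1 → Adj G u v
Walk¹⇒Adj (e ∷ []) = e

_++ʷ_ : ∀ {G u w v i j} → Walk G u w i → Walk G w v j → Walk G u v (i + j)
[]      ++ʷ B = B
(e ∷ A) ++ʷ B = e ∷ (A ++ʷ B)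

∈-initVerts-++ʷ : ∀ {G u w v i j} (A : Walk G u w i) (B : Walk G w v (suc j)) →
  w ∈ₗ initVerts (A ++ʷ B)
∈-initVerts-++ʷ []      (e ∷ B) = here refl
∈-initVerts-++ʷ (e ∷ A) B       = there (∈-initVerts-++ʷ A B)

∈-inner-++ʷ : ∀ {G u w v i j} (A : Walk G u w (suc i)) (B : Walk G w v (suc j)) →
  w ∈ₗ inner (A ++ʷ B)
∈-inner-++ʷ (e ∷ A) B = ∈-initVerts-++ʷ A B

split-initVerts : ∀ {G u v k x} (W : Walk G u v k) → x ∈ₗ initVerts W →
  ∃[ i ] ∃[ j ] (Walk G u x i × Walk G x v (suc j) × i + suc j ≡ k)
split-initVerts (e ∷ W) (here refl) = 0 , _ , [] , e ∷ W , refl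
split-initVerts (e ∷ W) (there x∈W) with split-initVerts W x∈W
... | i , j , A , B , i+j≡k = suc i , j , e ∷ A , B , cong suc i+j≡k

split-inner : ∀ {G u v k x} (W : Walk G u v k) → x ∈ₗ inner W →
  ∃[ i ] ∃[ j ] (Walk G u x (suc i) × Walk G x v (suc j) × suc i + suc j ≡ k)
split-inner (e ∷ W) x∈W with split-initVerts W x∈W
... | i , j , A , B , i+j≡k = i , j , e ∷ A , B , cong suc i+j≡k

inner⇒2≤length : ∀ {G u v k x} (W : Walk G u v k) → x ∈ₗ inner W → 2 ≤ k
inner⇒2≤length (_ ∷ _ ∷ _) _ = s≤s (s≤s z≤n)

≡⊎Adj⇒Positionable : ∀ {G} X {u v} → u ≡ v ⊎ Adj G u v → Positionable G X u v
≡⊎Adj⇒Positionable X (inj₁ refl) k W shortest x x∈W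
  with () ← ≤-trans (inner⇒2≤length W x∈W) (shortest 0 [])
≡⊎Adj⇒Positionable X (inj₂ e) k W shortest x x∈W
  with s≤s () ← ≤-trans (inner⇒2≤length W x∈W) (shortest 1 (e ∷ []))

∅-isDualGP : ∀ {G} → IsDualGP G ⊥
∅-isDualGP = (λ _ _ _ _ _ _ _ _ _ → ∉⊥) , (λ _ _ _ _ _ _ _ _ _ → ∉⊥)

preimage-isDualGP : ∀ {G₁ G₂} (f : V G₁ → V G₂) {X} →
  (∀ u v → Positionable G₂ X (f u) (f v) → Positionable G₁ (preimage f X) u v) →
  IsDualGP G₂ X → IsDualGP G₁ (preimage f X)
preimage-isDualGP f {X} pullback (inX , outX) =
  (λ u v u∈ v∈ → pullback u v (inX _ _ (∈-preimage⁻ f X u∈) (∈-preimage⁻ f X v∈))) ,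
  (λ u v u∉ v∉ → pullback u v (outX _ _ (u∉ ∘ ∈-preimage⁺ f X) (v∉ ∘ ∈-preimage⁺ f X)))

record Midpoint (G : Graph) (p i q : V G) : Set where
  field
    distinct    : p ≢ q
    nonadjacent : ¬ Adj G p q
    left        : Adj G p i
    right       : Adj G i q

Midpoint⇒∉ : ∀ {G X p i q} → Positionable G X p q → Midpoint G p i q → i ∉ X
Midpoint⇒∉ pos m = pos 2 (left ∷ right ∷ []) shortest _ (here refl)
  where
  open Midpoint m
  shortest : IsShortest (left ∷ right ∷ [])
  shortest 0             W = contradiction (Walk⁰⇒≡ W) distinct
  shortest 1             W = contradiction (Walk¹⇒Adj W) nonadjacent
  shortest (suc (suc _)) _ = s≤s (s≤s z≤n)

Midpoint-triangle⇒∉ : ∀ {G X p q r i} → IsDualGP G X →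
  Midpoint G p i q → Midpoint G p i r → Midpoint G q i r → i ∉ X
Midpoint-triangle⇒∉ {X = X} {p} {q} {r} (inX , outX) pq pr qr with p ∈? X | q ∈? X | r ∈? X
... | yes p∈ | yes q∈ | _      = Midpoint⇒∉ (inX _ _ p∈ q∈) pq
... | no p∉  | no q∉  | _      = Midpoint⇒∉ (outX _ _ p∉ q∉) pq
... | yes p∈ | no _   | yes r∈ = Midpoint⇒∉ (inX _ _ p∈ r∈) pr
... | yes _  | no q∉  | no r∉  = Midpoint⇒∉ (outX _ _ q∉ r∉) qr
... | no _   | yes q∈ | yes r∈ = Midpoint⇒∉ (inX _ _ q∈ r∈) qr
... | no p∉  | yes _  | no r∉  = Midpoint⇒∉ (outX _ _ p∉ r∉) pr

¬Simplicial⇒nonadjacent-neighbours : ∀ G v → ¬ Simplicial G v →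
  ∃[ a ] ∃[ b ] (Adj G v a × Adj G v b × a ≢ b × ¬ Adj G a b)
¬Simplicial⇒nonadjacent-neighbours G v ¬simplicial
  with any? (λ a → any? λ b →
         T? (adj G v a) ×-dec T? (adj G v b) ×-dec ¬? (a ≟ b) ×-dec ¬? (T? (adj G a b)))
... | yes witness = witness
... | no none     = contradiction simplicial ¬simplicial
  where
  simplicial : Simplicial G v
  simplicial a b va vb a≢b =
    decidable-stable (T? (adj G a b)) λ a≁b → none (a , b , va , vb , a≢b , a≁b)

module Lexicographic (G H : Graph) where

  ⟨_,_⟩ : V G → V H → V (G ∘ₗ H)
  ⟨ g , h ⟩ = combine g h

  π : V (G ∘ₗ H) → V G
  π u = proj₁ (remQuot {order G} (order H) u)

  ρ : V (G ∘ₗ H) → V H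
  ρ u = proj₂ (remQuot {order G} (order H) u)

  layer : V H → V G → V (G ∘ₗ H)
  layer h g = ⟨ g , h ⟩

  π-⟨⟩ : ∀ g h → π ⟨ g , h ⟩ ≡ g
  π-⟨⟩ g h = cong proj₁ (remQuot-combine g h)

  ρ-⟨⟩ : ∀ g h → ρ ⟨ g , h ⟩ ≡ h
  ρ-⟨⟩ g h = cong proj₂ (remQuot-combine g h)

  ⟨π,ρ⟩ : ∀ u → ⟨ π u , ρ u ⟩ ≡ u
  ⟨π,ρ⟩ = combine-remQuot {order G} (order H)

  Adj-base : ∀ {u w g g'} → π u ≡ g → π w ≡ g' → Adj G g g' → Adj (G ∘ₗ H) u w
  Adj-base {u} {w} refl refl e = Equivalence.from (T-∨ {adj G (π u) (π w)}) (inj₁ e)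

  Adj-fibre : ∀ {u w} → π u ≡ π w → Adj H (ρ u) (ρ w) → Adj (G ∘ₗ H) u w
  Adj-fibre {u} {w} same e =
    Equivalence.from (T-∨ {adj G (π u) (π w)})
      (inj₂ (Equivalence.from (T-∧ {⌊ π u ≟ π w ⌋}) (fromWitness same , e)))

  Adj-cases : ∀ {u w} → Adj (G ∘ₗ H) u w →
    Adj G (π u) (π w) ⊎ (π u ≡ π w × Adj H (ρ u) (ρ w))
  Adj-cases {u} {w} e with Equivalence.to (T-∨ {adj G (π u) (π w)}) e
  ... | inj₁ e' = inj₁ e'
  ... | inj₂ e' with Equivalence.to (T-∧ {⌊ π u ≟ π w ⌋}) e'
  ...   | same , e'' = inj₂ (toWitness same , e'')

  project : ∀ {u v k} → Walk (G ∘ₗ H) u v k → ∃[ k' ] (k' ≤ k × Walk G (π u) (π v) k')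
  project [] = 0 , z≤n , []
  project (e ∷ W) with project W | Adj-cases e
  ... | k' , k'≤k , W' | inj₁ e'         = suc k' , s≤s k'≤k , e' ∷ W'
  ... | k' , k'≤k , W' | inj₂ (same , _) =
    k' , m≤n⇒m≤1+n k'≤k , subst (λ g → Walk G g _ k') (sym same) W'

  lift : ∀ h {u v g g' m} → π u ≡ g → π v ≡ g' → Walk G g g' (suc m) → Walk (G ∘ₗ H) u v (suc m)
  lift h πu πv (e ∷ []) = Adj-base πu πv e ∷ []
  lift h πu πv (_∷_ {w = x} e (e' ∷ W)) =
    Adj-base πu (π-⟨⟩ x h) e ∷ lift h {u = ⟨ x , h ⟩} (π-⟨⟩ x h) πv (e' ∷ W)

  lift-inner : ∀ h {u v g g' m x} (πu : π u ≡ g) (πv : π v ≡ g') (W : Walk G g g' (suc m)) →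
    x ∈ₗ inner W → ⟨ x , h ⟩ ∈ₗ inner (lift h πu πv W)
  lift-inner h πu πv (e ∷ e' ∷ [])       (here refl) = here refl
  lift-inner h πu πv (e ∷ e' ∷ e'' ∷ W) (here refl) = here refl
  lift-inner h πu πv (e ∷ e' ∷ e'' ∷ W) (there x∈W) =
    there (lift-inner h (π-⟨⟩ _ h) πv (e' ∷ e'' ∷ W) x∈W)

  lift-isShortest : ∀ h {u v g g' m} (πu : π u ≡ g) (πv : π v ≡ g') (W : Walk G g g' (suc m)) →
    IsShortest W → IsShortest (lift h πu πv W)
  lift-isShortest h refl refl W shortest k W'' with project W''
  ... | k' , k'≤k , W' = ≤-trans (shortest k' W') k'≤k

  IsShortest⇒≤-base : ∀ {u v k} (W : Walk (G ∘ₗ H) u v k) → π u ≢ π v → IsShortest W →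
    ∀ k' → Walk G (π u) (π v) k' → k ≤ k'
  IsShortest⇒≤-base W πu≢πv shortest zero    W' = contradiction (Walk⁰⇒≡ W') πu≢πv
  IsShortest⇒≤-base {u} W πu≢πv shortest (suc k') W' = shortest (suc k') (lift (ρ u) refl refl W')

  inner-between-fibres : ∀ {u v k x} (W : Walk (G ∘ₗ H) u v k) → π u ≢ π v → IsShortest W →
    x ∈ₗ inner W → ∃[ k' ] Σ (Walk G (π u) (π v) k') λ W' → IsShortest W' × π x ∈ₗ inner W'
  inner-between-fibres W πu≢πv shortest x∈W with split-inner W x∈W
  ... | i , j , A , B , i+j≡k with project A | project B
  ... | a , a≤ , A' | b , b≤ , B'
    -- base walks lift, so the projected halves cannot be shorter than A and B
    with refl , refl ← +-≤-tight a≤ b≤ (≤-trans (≤-reflexive i+j≡k)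
                         (IsShortest⇒≤-base W πu≢πv shortest (a + b) (A' ++ʷ B')))
    = suc i + suc j , A' ++ʷ B' ,
      (λ k' W' → ≤-trans (≤-reflexive i+j≡k) (IsShortest⇒≤-base W πu≢πv shortest k' W')) ,
      ∈-inner-++ʷ A' B'

  preimage-π-positionable : ∀ X {u v} → π u ≢ π v →
    Positionable G X (π u) (π v) → Positionable (G ∘ₗ H) (preimage π X) u v
  preimage-π-positionable X πu≢πv pos k W shortest x x∈W x∈π⁻¹X
    with inner-between-fibres W πu≢πv shortest x∈W
  ... | k' , W' , shortest' , πx∈W' = pos k' W' shortest' (π x) πx∈W' (∈-preimage⁻ π X x∈π⁻¹X)

  layer-preimage-positionable : ∀ Y h g g' →
    Positionable (G ∘ₗ H) Y ⟨ g , h ⟩ ⟨ g' , h ⟩ → Positionable G (preimage (layer h) Y) g g'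
  layer-preimage-positionable Y h g g' pos _ W@(_ ∷ _) shortest x x∈W x∈Y =
    pos _ (lift h (π-⟨⟩ g h) (π-⟨⟩ g' h) W) (lift-isShortest h (π-⟨⟩ g h) (π-⟨⟩ g' h) W shortest)
      ⟨ x , h ⟩ (lift-inner h (π-⟨⟩ g h) (π-⟨⟩ g' h) W x∈W) (∈-preimage⁻ (layer h) Y x∈Y)

  layer-preimage-isDualGP : ∀ {Y} → IsDualGP (G ∘ₗ H) Y → ∀ h → IsDualGP G (preimage (layer h) Y)
  layer-preimage-isDualGP {Y} dual h =
    preimage-isDualGP (layer h) (layer-preimage-positionable Y h) dual

  ∣preimage-π∣ : ∀ X → ∣ preimage π X ∣ ≡ order H * ∣ X ∣
  ∣preimage-π∣ X = begin
    ∣ preimage π X ∣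
      ≡⟨ ∣p∣≡∑χ (preimage π X) ⟩
    sum (χ (preimage π X))
      ≡⟨ ∑-combine (order G) (order H) _ ⟩
    ∑[ g < order G ] ∑[ h < order H ] χ (preimage π X) ⟨ g , h ⟩
      ≡⟨ sum-cong-≗ (λ g → sum-cong-≗ λ h → trans (χ-preimage π X _) (cong (χ X) (π-⟨⟩ g h))) ⟩
    ∑[ g < order G ] ∑[ h < order H ] χ X g
      ≡⟨ sum-cong-≗ (λ g → ∑-const (order H) (χ X g)) ⟩
    ∑[ g < order G ] (order H * χ X g)
      ≡⟨ *-distribˡ-sum (order H) (χ X) ⟨
    order H * sum (χ X)
      ≡⟨ cong (order H *_) (∣p∣≡∑χ X) ⟨
    order H * ∣ X ∣
      ∎
    where open ≡-Reasoning

  ∣∣≡∑∣layer-preimage∣ : ∀ Y → ∣ Y ∣ ≡ ∑[ h < order H ] ∣ preimage (layer h) Y ∣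
  ∣∣≡∑∣layer-preimage∣ Y = begin
    ∣ Y ∣
      ≡⟨ ∣p∣≡∑χ Y ⟩
    sum (χ Y)
      ≡⟨ ∑-combine (order G) (order H) _ ⟩
    ∑[ g < order G ] ∑[ h < order H ] χ Y ⟨ g , h ⟩
      ≡⟨ ∑-comm (λ g h → χ Y ⟨ g , h ⟩) ⟩
    ∑[ h < order H ] ∑[ g < order G ] χ Y ⟨ g , h ⟩
      ≡⟨ sum-cong-≗ (λ h → sum-cong-≗ (χ-preimage (layer h) Y)) ⟨
    ∑[ h < order H ] sum (χ (preimage (layer h) Y))
      ≡⟨ sum-cong-≗ (λ h → ∣p∣≡∑χ (preimage (layer h) Y)) ⟨
    ∑[ h < order H ] ∣ preimage (layer h) Y ∣
      ∎
    where open ≡-Reasoning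

  isDualGP-∣∣≤ : ∀ {k} → (∀ X → IsDualGP G X → ∣ X ∣ ≤ k) →
    ∀ Y → IsDualGP (G ∘ₗ H) Y → ∣ Y ∣ ≤ order H * k
  isDualGP-∣∣≤ {k} bound Y dual = begin
    ∣ Y ∣                                      ≡⟨ ∣∣≡∑∣layer-preimage∣ Y ⟩
    ∑[ h < order H ] ∣ preimage (layer h) Y ∣  ≤⟨ ∑-mono-≤ (λ h → bound _ (layer-preimage-isDualGP dual h)) ⟩
    ∑[ h < order H ] k                         ≡⟨ ∑-const (order H) k ⟩
    order H * k                                ∎
    where open ≤-Reasoning

  ⟨⟩-injective : ∀ {a b x y} → ⟨ a , x ⟩ ≡ ⟨ b , y ⟩ → a ≡ b × x ≡ y
  ⟨⟩-injective {a} {b} {x} {y} = combine-injective a x b y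

  ¬Adj-⟨⟩ : ∀ {a b x y} → ¬ Adj G a b → (a ≡ b → ¬ Adj H x y) → ¬ Adj (G ∘ₗ H) ⟨ a , x ⟩ ⟨ b , y ⟩
  ¬Adj-⟨⟩ {a} {b} {x} {y} a≁b x≁y e with Adj-cases e
  ... | inj₁ e'         = a≁b (subst₂ (Adj G) (π-⟨⟩ a x) (π-⟨⟩ b y) e')
  ... | inj₂ (same , e') = x≁y (trans (sym (π-⟨⟩ a x)) (trans same (π-⟨⟩ b y)))
                               (subst₂ (Adj H) (ρ-⟨⟩ a x) (ρ-⟨⟩ b y) e')

  noSimplicial⇒∉ : IsSimple G → NoSimplicial G → NoSimplicial H →
    ∀ {Y} → IsDualGP (G ∘ₗ H) Y → ∀ g h → ⟨ g , h ⟩ ∉ Y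
  noSimplicial⇒∉ simple nsG nsH dual g h
    with ¬Simplicial⇒nonadjacent-neighbours G g (nsG g)
       | ¬Simplicial⇒nonadjacent-neighbours H h (nsH h)
  ... | g₁ , g₂ , gg₁ , gg₂ , g₁≢g₂ , g₁≁g₂ | h₁ , h₂ , _ , _ , h₁≢h₂ , h₁≁h₂ =
    Midpoint-triangle⇒∉ dual
      (midpoint gg₁ gg₁ (λ _ → h₁≢h₂) (adj-irrefl g₁) (λ _ → h₁≁h₂))
      (midpoint {x = h₁} {y = h} gg₁ gg₂ (⊥-elim ∘ g₁≢g₂) g₁≁g₂ (⊥-elim ∘ g₁≢g₂))
      (midpoint {x = h₂} {y = h} gg₁ gg₂ (⊥-elim ∘ g₁≢g₂) g₁≁g₂ (⊥-elim ∘ g₁≢g₂))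
    where
    open IsSimple simple
    midpoint : ∀ {a b x y} → Adj G g a → Adj G g b → (a ≡ b → x ≢ y) → ¬ Adj G a b →
      (a ≡ b → ¬ Adj H x y) → Midpoint (G ∘ₗ H) ⟨ a , x ⟩ ⟨ g , h ⟩ ⟨ b , y ⟩
    midpoint {a} {b} {x} {y} ga gb x≢y a≁b x≁y = record
      { distinct    = λ eq → let a≡b , x≡y = ⟨⟩-injective eq in x≢y a≡b x≡y
      ; nonadjacent = ¬Adj-⟨⟩ a≁b x≁y
      ; left        = Adj-base (π-⟨⟩ a x) (π-⟨⟩ g h) (adj-sym g a ga)
      ; right       = Adj-base (π-⟨⟩ g h) (π-⟨⟩ b y) gb
      }

  noSimplicial⇒≡∅ : IsSimple G → NoSimplicial G → NoSimplicial H →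
    ∀ {Y} → IsDualGP (G ∘ₗ H) Y → Y ≡ ⊥
  noSimplicial⇒≡∅ simple nsG nsH dual = Empty-unique λ (u , u∈Y) →
    noSimplicial⇒∉ simple nsG nsH dual (π u) (ρ u) (subst (_∈ _) (sym (⟨π,ρ⟩ u)) u∈Y)

  gpd-noSimplicial : IsSimple G → NoSimplicial G → NoSimplicial H → IsGpd (G ∘ₗ H) 0
  gpd-noSimplicial simple nsG nsH = (⊥ , ∅-isDualGP , ∣∅∣≡0) , λ Y dual →
    ≤-reflexive (trans (cong ∣_∣ (noSimplicial⇒≡∅ simple nsG nsH dual)) ∣∅∣≡0)
    where
    ∣∅∣≡0 : ∣ ⊥ {order G * order H} ∣ ≡ 0
    ∣∅∣≡0 = ∣⊥∣≡0 (order G * order H)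

module _ (G : Graph) (n : ℕ) where
  open Lexicographic G (K n)

  sameFibre⇒≡⊎Adj : ∀ {u v} → π u ≡ π v → u ≡ v ⊎ Adj (G ∘ₗ K n) u v
  sameFibre⇒≡⊎Adj {u} {v} same =
    Sum.map (λ ρu≡ρv → trans (sym (⟨π,ρ⟩ u)) (trans (cong₂ ⟨_,_⟩ same ρu≡ρv) (⟨π,ρ⟩ v)))
            (Adj-fibre same ∘ fromWitnessFalse)
            (toSum (ρ u ≟ ρ v))

  preimage-π-isDualGP : ∀ {X} → IsDualGP G X → IsDualGP (G ∘ₗ K n) (preimage π X)
  preimage-π-isDualGP {X} = preimage-isDualGP π pullback
    where
    pullback : ∀ u v → Positionable G X (π u) (π v) → Positionable (G ∘ₗ K n) (preimage π X) u v
    pullback u v pos with π u ≟ π v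
    ... | yes same    = ≡⊎Adj⇒Positionable (preimage π X) (sameFibre⇒≡⊎Adj same)
    ... | no πu≢πv    = preimage-π-positionable X πu≢πv pos

  gpd-∘K : ∀ {k} → IsGpd G k → IsGpd (G ∘ₗ K n) (n * k)
  gpd-∘K ((X , dual , ∣X∣≡k) , bound) =
    (preimage π X , preimage-π-isDualGP dual , trans (∣preimage-π∣ X) (cong (n *_) ∣X∣≡k)) ,
    isDualGP-∣∣≤ bound

theorem5p9 : (G : Graph) → IsSimple G → Connected G →
    ((H : Graph) → IsSimple H → Connected H →
       NoSimplicial G → NoSimplicial H → IsGpd (G ∘ₗ H) 0)
    × ((n : ℕ) → n ≥ 1 → (k : ℕ) → IsGpd G k → IsGpd (G ∘ₗ K n) (n * k))
theorem5p9 G simple _ =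
  (λ H _ _ nsG nsH → Lexicographic.gpd-noSimplicial G H simple nsG nsH) ,
  (λ n _ _ → gpd-∘K G n)
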